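{- Let $H=(h_{ij})_{i,j=1}^{g\lambda}$ be a generalized Hadamard matrix $GH(g,\lambda)$ over a finite abelian group of order $g$ with permutation representation $\phi$. For each $i$ let $\phi(h_i)=(\phi(h_{i1}),\ldots,\phi(h_{i,g\lambda}))$ be the $g\times g^2\lambda$ matrix formed by the $i$-th row, set $D_{ij}=\phi(h_j)^\top\phi(h_i)$ ($g^2\lambda\times g^2\lambda$) for $i,j\in\{1,\ldots,g\lambda\}$, and let $M=(D_{ij})_{i,j=1}^{g\lambda}$. Then $M$ is the incidence matrix of a symmetric group divisible design with parameters $(g^3\lambda^2,g^2\lambda^2,g^2\lambda^2,g,0,g\lambda^2)$.
   Context: $I_n,J_n$ denote the identity and all-ones matrices of order $n$; $\otimes$ is the Kronecker product. A generalized Hadamard matrix $GH(g,\lambda)$ over an additively written abelian group $G$ of order $g$ is a square matrix $H=(h_{ij})$ of order $g\lambda$ with entries in $G$ such that for all distinct rows $i,k$ the multiset $\{h_{ij}-h_{kj}:1\le j\le g\lambda\}$ contains each element of $G$ exactly $\lambda$ times. Write $G\cong\mathbb{Z}_{n_1}\oplus\cdots\oplus\mathbb{Z}_{n_s}$, so $g=n_1\cdots n_s$; let $r_p$ be the $p\times p$ circulant permutation matrix with first row $(0,1,0,\ldots,0)$; the permutation representation is $\phi((x_i)_{i=1}^s)=r_{n_1}^{x_1}\otimes\cdots\otimes r_{n_s}^{x_s}$. A $v\times v$ $(0,1)$-matrix $A$ ($v=mn$) is the incidence matrix of a symmetric group divisible design with parameters $(v,k,m,n,\lambda_1,\lambda_2)$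 if $AA^\top=A^\top A=kI_v+\lambda_1(I_m\otimes J_n-I_v)+\lambda_2(J_v-I_m\otimes J_n)$. -}

module Defs where

open import Data.Nat using (ℕ; zero; suc; _+_; _*_; _∸_; _≡ᵇ_)
open import Data.Nat.DivMod using (_%_)
open import Data.Nat.DivMod using (m%n<n)
open import Data.Bool using (Bool; true; false; if_then_else_; _∧_)
open import Data.Fin using (Fin; toℕ; fromℕ<; remQuot; cast)
open import Data.List using (List; []; _∷_)
open import Data.Nat.ListAction using (product)
open import Data.Product using (_×_; _,_; Σ)
open import Data.Sum using (_⊎_)
open import Data.Unit using (⊤; tt)
open import Relation.Binary.PropositionalEquality using (_≡_; trans)

Mat : ℕ → ℕ → Set
Mat m n = Fin m → Fin n → ℕ

sumF : ∀ {n} → (Fin n → ℕ) → ℕ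
sumF {zero} f = 0
sumF {suc n} f = f Fin.zero + sumF (λ i → f (Fin.suc i))


mmul : ∀ {m n p} → Mat m n → Mat n p → Mat m p
mmul A B i k = sumF (λ j → A i j * B j k)

transpose : ∀ {m n} → Mat m n → Mat n m
transpose A i j = A j i

Id : (n : ℕ) → Mat n n
Id n i j = if toℕ i ≡ᵇ toℕ j then 1 else 0

Jm : (n : ℕ) → Mat n n
Jm n i j = 1

-- Kronecker product; index (i,k) of Fin (m * p) is i * p + k (Data.Fin.combine / remQuot)
kron : ∀ {m n p q} → Mat m n → Mat p q → Mat (m * p) (n * q)
kron {m} {n} {p} {q} A B r c with remQuot p r | remQuot q c
... | i , k | j , l = A i j * B k l

mpow : ∀ {n} → Mat n n → ℕ → Mat n n
mpow {n} A zero = Id n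
mpow A (suc e) = mmul A (mpow A e)

circ : (p : ℕ) → Mat p p
circ zero ()
circ (suc m) a b = if toℕ b ≡ᵇ (suc (toℕ a) % suc m) then 1 else 0

-- Elements of G = Z_{n1} ⊕ ... ⊕ Z_{ns}
Elem : List ℕ → Set
Elem [] = ⊤
Elem (n ∷ ns) = Fin n × Elem ns

subF : ∀ {n} → Fin n → Fin n → Fin n
subF {zero} ()
subF {suc m} a b = fromℕ< (m%n<n (toℕ a + (suc m ∸ toℕ b)) (suc m))

subE : ∀ {ns} → Elem ns → Elem ns → Elem ns
subE {[]} _ _ = tt
subE {n ∷ ns} (a , x) (b , y) = subF a b , subE x y

eqE : ∀ {ns} → Elem ns → Elem ns → Bool
eqE {[]} _ _ = true
eqE {n ∷ ns} (a , x) (b , y) = (toℕ a ≡ᵇ toℕ b) ∧ eqE x y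

countF : ∀ {n} → (Fin n → Bool) → ℕ
countF P = sumF (λ j → if P j then 1 else 0)

φ : (ns : List ℕ) → Elem ns → Mat (product ns) (product ns)
φ [] _ = Id 1
φ (n ∷ ns) (x , xs) = kron (mpow (circ n) (toℕ x)) (φ ns xs)

IsGH : (ns : List ℕ) (l : ℕ) → (Fin (product ns * l) → Fin (product ns * l) → Elem ns) → Set
IsGH ns l H = ∀ i k → ¬≡ i k → ∀ (x : Elem ns) →
  countF (λ j → eqE (subE (H i j) (H k j)) x) ≡ l
  where
  open import Relation.Binary.PropositionalEquality using (_≢_)
  ¬≡ : Fin (product ns * l) → Fin (product ns * l) → Set
  ¬≡ i k = i ≢ k

phiRow : (ns : List ℕ) (l : ℕ) → (Fin (product ns * l) → Fin (product ns * l) → Elem ns) →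
         Fin (product ns * l) → Mat (product ns) ((product ns * l) * product ns)
phiRow ns l H i a c with remQuot (product ns) c
... | j , b = φ ns (H i j) a b

Dmat : (ns : List ℕ) (l : ℕ) → (Fin (product ns * l) → Fin (product ns * l) → Elem ns) →
       Fin (product ns * l) → Fin (product ns * l) →
       Mat ((product ns * l) * product ns) ((product ns * l) * product ns)
Dmat ns l H i j = mmul (transpose (phiRow ns l H j)) (phiRow ns l H i)

Mmat : (ns : List ℕ) (l : ℕ) → (Fin (product ns * l) → Fin (product ns * l) → Elem ns) →
       Mat ((product ns * l) * ((product ns * l) * product ns))
           ((product ns * l) * ((product ns * l) * product ns))
Mmat ns l H r c with remQuot ((product ns * l) * product ns) r
                   | remQuot ((product ns * l) * product ns) c
... | i , r' | j , c' = Dmat ns l H i j r' c'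

-- A (d×d matrix) is the incidence matrix of a symmetric group divisible design
-- with parameters (v,k,m,n,l1,l2): d = v = m n, A is a (0,1)-matrix, and
-- AAᵀ = AᵀA = k I + l1 (I_m ⊗ J_n − I) + l2 (J − I_m ⊗ J_n)
-- (the subtractions are entrywise on ℕ and never truncate, since I ≤ I_m⊗J_n ≤ J entrywise)
IsSGDD : (v k m n l1 l2 : ℕ) → ∀ {d} → Mat d d → Set
IsSGDD v k m n l1 l2 {d} A =
  Σ (d ≡ v) λ e1 → Σ (v ≡ m * n) λ e2 →
    (∀ r c → A r c ≡ 0 ⊎ A r c ≡ 1) ×
    (∀ r c → mmul A (transpose A) r c ≡ rhs (trans e1 e2) r c) ×
    (∀ r c → mmul (transpose A) A r c ≡ rhs (trans e1 e2) r c)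
  where
  rhs : d ≡ m * n → Mat d d
  rhs e r c =
    let B = kron (Id m) (Jm n) (cast e r) (cast e c)
        I = Id d r c
    in k * I + l1 * (B ∸ I) + l2 * (1 ∸ B)

-- Write G additively and index the rows and columns of M by triples (i, j, b) with i, j ∈ [gλ] and
-- b ∈ G, so that φ(x) has a 1 in row a and column b exactly when b = a + x.  Then φ(x)ᵀφ(y) = φ(y − x),
-- and M has a 1 in row (i, j₁, b₁) and column (j, j₂, b₂) exactly when b₁ + h_{ij₂} = b₂ + h_{jj₁}.
-- Summing out the G-coordinate, every entry of MMᵀ and of MᵀM becomes the number of pairs (b, a) with
-- (p + h_{ra}) + h_{bc′} = (q + h_{r′a}) + h_{bc}, for suitable r, r′, c, c′ and p, q ∈ G.  This number
-- is gλ² if r ≠ r′, by the generalized Hadamard property of the rows of H; it is gλ² if r = r′ and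
-- c ≠ c′, by the same property of the columns; and it is (gλ)²[p = q] if (r, c) = (r′, c′).
--
-- The columns of H satisfy the property by a counting argument.  For columns c ≠ c′ let N(t) be the
-- number of rows b with h_{bc} − h_{bc′} = t; then Σ_t N(t) = gλ, hence
-- Σ_t N(t)² = gλ² + Σ_t (N(t) − λ)².  Summed over all pairs of columns, Σ_t N(t)² counts the
-- quadruples (b, b′, c, c′) with h_{bc} − h_{bc′} = h_{b′c} − h_{b′c′}; counting them by pairs of rows
-- instead, the row property leaves no room for the deviation terms, so N(t) = λ throughout.

module Submission where

open import Defs
open import Level using (0ℓ)
open import Algebra.Core using (Op₁; Op₂)
open import Algebra.Bundles using (AbelianGroup)
import Algebra.Structures as Structures
open import Algebra.Consequences.Propositional using (comm∧idˡ⇒id; comm∧invʳ⇒inv)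
open import Data.Bool using (T; if_then_else_)
open import Data.Bool.Properties using (T-∧)
open import Data.Empty using (⊥-elim)
open import Data.Fin using (Fin; toℕ; fromℕ<; _↑ˡ_; _↑ʳ_; combine; remQuot; cast)
import Data.Fin.Properties as Fin
open import Data.List using (List; []; _∷_)
open import Data.List.Relation.Unary.All using (All; []; _∷_)
open import Data.Nat using (ℕ; zero; suc; _+_; _*_; _∸_; ∣_-_∣; _≤_; s≤s; NonZero)
open import Data.Nat.DivMod using (_%_; m%n<n; %-distribˡ-+; m%n%n≡m%n; m<n⇒m%n≡m; n%n≡0)
open import Data.Nat.ListAction using (product)
open import Data.Nat.Properties
  using ( +-*-semiring; +-identityʳ; +-comm; +-assoc; +-suc; +-cancelʳ-≡; +-cancelˡ-≡; *-identityʳ; *-zeroʳ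
        ; m+[n∸m]≡n; ≡ᵇ⇒≡; ≡⇒≡ᵇ; m+n≡0⇒m≡0; m+n≡0⇒n≡0; m*n≡0⇒m≡0∨n≡0; ∣m-n∣≡0⇒m≡n )
import Data.Nat.Properties as ℕ
open import Data.Nat.Tactic.RingSolver using (solve-∀)
open import Data.Product using (_×_; _,_; proj₁; proj₂)
open import Data.Sum using (_⊎_; inj₁; inj₂; [_,_]′)
open import Data.Unit using (tt)
open import Function.Base using (_∘_; id)
open import Function.Bundles using (_⇔_; mk⇔; Equivalence; _↔_; mk↔ₛ′; Inverse)
open import Relation.Binary.Definitions using (DecidableEquality)
open import Relation.Binary.PropositionalEquality
open import Relation.Nullary using (Dec; does; yes; no)
open import Relation.Nullary.Decidable using (dec-true; dec-false; map′; T?; _×-dec_)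
open import Algebra.Properties.Semiring.Sum +-*-semiring
  using (sum-syntax; sum-cong-≗; ∑-distrib-+; ∑-comm; *-distribˡ-sum; *-distribʳ-sum)

sumF≡∑ : ∀ {n} (f : Fin n → ℕ) → sumF f ≡ ∑[ i < n ] f i
sumF≡∑ {zero} f = refl
sumF≡∑ {suc n} f = cong (f Fin.zero +_) (sumF≡∑ (f ∘ Fin.suc))

∑-const : ∀ n c → ∑[ i < n ] c ≡ n * c
∑-const zero c = refl
∑-const (suc n) c = cong (c +_) (∑-const n c)

∑-*-∑ : ∀ {m n} (f : Fin m → ℕ) (h : Fin n → ℕ) →
        (∑[ i < m ] f i) * (∑[ j < n ] h j) ≡ ∑[ i < m ] ∑[ j < n ] (f i * h j)
∑-*-∑ f h = trans (*-distribʳ-sum _ f) (sum-cong-≗ λ i → *-distribˡ-sum (f i) h)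

∑-comm₄ : ∀ {p q r s} (f : Fin p → Fin q → Fin r → Fin s → ℕ) →
          ∑[ a < p ] ∑[ b < q ] ∑[ c < r ] ∑[ d < s ] f a b c d ≡
          ∑[ c < r ] ∑[ d < s ] ∑[ a < p ] ∑[ b < q ] f a b c d
∑-comm₄ f = begin
  ∑[ a < _ ] ∑[ b < _ ] ∑[ c < _ ] ∑[ d < _ ] f a b c d ≡⟨ sum-cong-≗ (λ a → ∑-comm (λ b c → ∑[ d < _ ] f a b c d)) ⟩
  ∑[ a < _ ] ∑[ c < _ ] ∑[ b < _ ] ∑[ d < _ ] f a b c d ≡⟨ ∑-comm (λ a c → ∑[ b < _ ] ∑[ d < _ ] f a b c d) ⟩
  ∑[ c < _ ] ∑[ a < _ ] ∑[ b < _ ] ∑[ d < _ ] f a b c d ≡⟨ sum-cong-≗ (λ c → sum-cong-≗ λ a → ∑-comm (λ b d → f a b c d)) ⟩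
  ∑[ c < _ ] ∑[ a < _ ] ∑[ d < _ ] ∑[ b < _ ] f a b c d ≡⟨ sum-cong-≗ (λ c → ∑-comm (λ a d → ∑[ b < _ ] f a b c d)) ⟩
  ∑[ c < _ ] ∑[ d < _ ] ∑[ a < _ ] ∑[ b < _ ] f a b c d ∎
  where open ≡-Reasoning

∑≡0⇒≗0 : ∀ {n} (f : Fin n → ℕ) → ∑[ i < n ] f i ≡ 0 → ∀ i → f i ≡ 0
∑≡0⇒≗0 f ∑f≡0 Fin.zero = m+n≡0⇒m≡0 (f Fin.zero) ∑f≡0
∑≡0⇒≗0 f ∑f≡0 (Fin.suc i) = ∑≡0⇒≗0 (f ∘ Fin.suc) (m+n≡0⇒n≡0 (f Fin.zero) ∑f≡0) i

∑-+-≡⇒≗0 : ∀ {n} (f e : Fin n → ℕ) → ∑[ i < n ] (f i + e i) ≡ ∑[ i < n ] f i → ∀ i → e i ≡ 0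
∑-+-≡⇒≗0 f e eq = ∑≡0⇒≗0 e (+-cancelˡ-≡ _ _ _ (trans (sym (∑-distrib-+ f e)) (trans eq (sym (+-identityʳ _)))))

∑-↑ : ∀ m {n} (f : Fin (m + n) → ℕ) →
      ∑[ r < m + n ] f r ≡ ∑[ i < m ] f (i ↑ˡ n) + ∑[ j < n ] f (m ↑ʳ j)
∑-↑ zero f = refl
∑-↑ (suc m) f = trans (cong (f Fin.zero +_) (∑-↑ m (f ∘ Fin.suc))) (sym (+-assoc (f Fin.zero) _ _))

∑-combine : ∀ m n (f : Fin (m * n) → ℕ) → ∑[ r < m * n ] f r ≡ ∑[ i < m ] ∑[ j < n ] f (combine i j)
∑-combine zero n f = refl
∑-combine (suc m) n f = trans (∑-↑ n f) (cong (∑[ j < n ] f (j ↑ˡ (m * n)) +_) (∑-combine m n (f ∘ (n ↑ʳ_))))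

-- For the deciders of ℕ, Fin and Elem used below, `does` unfolds to the Booleans `_≡ᵇ_` and `eqE`,
-- so the indicators `if … then 1 else 0` of Defs are 𝟙's by definition.
𝟙 : ∀ {a} {A : Set a} → Dec A → ℕ
𝟙 a? = if does a? then 1 else 0

𝟙-cong : ∀ {a b} {A : Set a} {B : Set b} → A ⇔ B → (a? : Dec A) (b? : Dec B) → 𝟙 a? ≡ 𝟙 b?
𝟙-cong A⇔B (yes a) b? rewrite dec-true b? (Equivalence.to A⇔B a) = refl
𝟙-cong A⇔B (no ¬a) b? rewrite dec-false b? (¬a ∘ Equivalence.from A⇔B) = refl

𝟙-sym : ∀ {a} {A : Set a} (_≟_ : DecidableEquality A) x y → 𝟙 (x ≟ y) ≡ 𝟙 (y ≟ x)
𝟙-sym _≟_ x y = 𝟙-cong (mk⇔ sym sym) (x ≟ y) (y ≟ x)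

∑-𝟙≟ : ∀ {n} (s : Fin n) (f : Fin n → ℕ) → ∑[ t < n ] (𝟙 (t Fin.≟ s) * f t) ≡ f s
∑-𝟙≟ {suc n} Fin.zero f =
  trans (cong₂ _+_ (+-identityʳ (f Fin.zero)) (trans (∑-const n 0) (*-zeroʳ n))) (+-identityʳ _)
∑-𝟙≟ {suc n} (Fin.suc s) f = ∑-𝟙≟ s (f ∘ Fin.suc)

𝟙-×-dec : ∀ {a b} {A : Set a} {B : Set b} (a? : Dec A) (b? : Dec B) → 𝟙 (a? ×-dec b?) ≡ 𝟙 a? * 𝟙 b?
𝟙-×-dec (yes _) b? = sym (+-identityʳ (𝟙 b?))
𝟙-×-dec (no _) b? = refl

𝟙∈01 : ∀ {a} {A : Set a} (a? : Dec A) → 𝟙 a? ≡ 0 ⊎ 𝟙 a? ≡ 1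
𝟙∈01 (yes _) = inj₂ refl
𝟙∈01 (no _) = inj₁ refl

onDiagonal : ∀ {m} → ℕ → ℕ → Fin m → Fin m → ℕ
onDiagonal a b i j = if does (i Fin.≟ j) then a else b

m²+n²≡∣m-n∣²+2mn : ∀ m n → m * m + n * n ≡ ∣ m - n ∣ * ∣ m - n ∣ + 2 * (m * n)
m²+n²≡∣m-n∣²+2mn zero n = sym (+-identityʳ (n * n))
m²+n²≡∣m-n∣²+2mn (suc m) zero = cong (suc m * suc m +_) (sym (cong (2 *_) (*-zeroʳ (suc m))))
m²+n²≡∣m-n∣²+2mn (suc m) (suc n) = begin
  suc m * suc m + suc n * suc n       ≡⟨ expandˡ m n ⟩
  (m * m + n * n) + 2 * (1 + m + n)   ≡⟨ cong (_+ 2 * (1 + m + n)) (m²+n²≡∣m-n∣²+2mn m n) ⟩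
  (d * d + 2 * (m * n)) + 2 * (1 + m + n) ≡⟨ expandʳ m n d ⟩
  d * d + 2 * (suc m * suc n)         ∎
  where
  open ≡-Reasoning
  d = ∣ m - n ∣
  expandˡ : ∀ m n → suc m * suc m + suc n * suc n ≡ (m * m + n * n) + 2 * (1 + m + n)
  expandˡ = solve-∀
  expandʳ : ∀ m n d → (d * d + 2 * (m * n)) + 2 * (1 + m + n) ≡ d * d + 2 * (suc m * suc n)
  expandʳ = solve-∀

∑N²≡gl²+∑∣N-l∣² : ∀ {g} l (N : Fin g → ℕ) → ∑[ t < g ] N t ≡ g * l →
  ∑[ t < g ] (N t * N t) ≡ g * l * l + ∑[ t < g ] (∣ N t - l ∣ * ∣ N t - l ∣)
∑N²≡gl²+∑∣N-l∣² {g} l N ∑N≡gl = +-cancelʳ-≡ (g * (l * l)) _ _ (begin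
  ∑[ t < g ] (N t * N t) + g * (l * l)       ≡⟨ cong (_ +_) (∑-const g (l * l)) ⟨
  ∑[ t < g ] (N t * N t) + ∑[ t < g ] (l * l) ≡⟨ ∑-distrib-+ (λ t → N t * N t) (λ _ → l * l) ⟨
  ∑[ t < g ] (N t * N t + l * l)             ≡⟨ sum-cong-≗ (λ t → m²+n²≡∣m-n∣²+2mn (N t) l) ⟩
  ∑[ t < g ] (D t + 2 * (N t * l))           ≡⟨ ∑-distrib-+ D (λ t → 2 * (N t * l)) ⟩
  ∑D + ∑[ t < g ] (2 * (N t * l))            ≡⟨ cong (∑D +_) (*-distribˡ-sum 2 (λ t → N t * l)) ⟨
  ∑D + 2 * ∑[ t < g ] (N t * l)              ≡⟨ cong (λ s → ∑D + 2 * s) (*-distribʳ-sum l N) ⟨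
  ∑D + 2 * (∑[ t < g ] N t * l)              ≡⟨ cong (λ s → ∑D + 2 * (s * l)) ∑N≡gl ⟩
  ∑D + 2 * (g * l * l)                       ≡⟨ rearrange g l ∑D ⟩
  g * l * l + ∑D + g * (l * l)               ∎)
  where
  open ≡-Reasoning
  D : Fin g → ℕ
  D t = ∣ N t - l ∣ * ∣ N t - l ∣
  ∑D = ∑[ t < g ] D t
  rearrange : ∀ g l d → d + 2 * (g * l * l) ≡ g * l * l + d + g * (l * l)
  rearrange = solve-∀

∑∣N-l∣²≡0⇒N≗l : ∀ {g} l (N : Fin g → ℕ) →
  ∑[ t < g ] (∣ N t - l ∣ * ∣ N t - l ∣) ≡ 0 → ∀ t → N t ≡ l
∑∣N-l∣²≡0⇒N≗l l N ∑D≡0 t =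
  ∣m-n∣≡0⇒m≡n ([ id , id ]′ (m*n≡0⇒m≡0∨n≡0 _ (∑≡0⇒≗0 _ ∑D≡0 t)))

module GeneralizedHadamard
  {G : Set} {op : Op₂ G} {e : G} {inv : Op₁ G}
  (isAbelianGroup : Structures.IsAbelianGroup _≡_ op e inv)
  (dec : DecidableEquality G)
  {g : ℕ} (enum : Fin g ↔ G)
  where

  -- Module parameters cannot carry fixities, so the operations are used through the bundle below
  -- and the decider through `_≟_`.
  infix 4 _≟_
  _≟_ : DecidableEquality G
  _≟_ = dec

  private
    abelianGroup : AbelianGroup 0ℓ 0ℓ
    abelianGroup = record { isAbelianGroup = isAbelianGroup }

  open AbelianGroup abelianGroup using (_∙_; _-_; assoc; comm; inverseʳ; commutativeSemigroup)
  open import Algebra.Properties.AbelianGroup abelianGroup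
    using (x≈z//y; //-rightDividesˡ; ∙-cancelʳ)
  open import Algebra.Properties.CommutativeSemigroup commutativeSemigroup
    using (x∙yz≈y∙xz; xy∙z≈y∙xz; xy∙z≈xz∙y)
  open Inverse enum using (strictlyInverseˡ; strictlyInverseʳ)
    renaming (to to ⟨_⟩; from to ⟨_⟩⁻¹)
  open Equivalence using (to; from)

  ∙≡⇔≡- : ∀ {x y z} → x ∙ y ≡ z ⇔ x ≡ z - y
  ∙≡⇔≡- {x} {y} {z} = mk⇔ (x≈z//y x y z) (λ x≡z-y → trans (cong (_∙ y) x≡z-y) (//-rightDividesˡ y z))

  ∙-cancelʳ-⇔ : ∀ {x y z} → x ∙ z ≡ y ∙ z ⇔ x ≡ y
  ∙-cancelʳ-⇔ {x} {y} {z} = mk⇔ (∙-cancelʳ z x y) (cong (_∙ z))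

  ∙≡∙⇔-≡- : ∀ {x y s t} → x ∙ s ≡ y ∙ t ⇔ x - y ≡ t - s
  ∙≡∙⇔-≡- {x} {y} {s} {t} = mk⇔
    (λ eq → ∙-cancelʳ (y ∙ s) _ _ (trans left (trans eq (sym right))))
    (λ eq → trans (sym left) (trans (cong (_∙ (y ∙ s)) eq) right))
    where
    left : (x - y) ∙ (y ∙ s) ≡ x ∙ s
    left = trans (sym (assoc (x - y) y s)) (cong (_∙ s) (//-rightDividesˡ y x))
    right : (t - s) ∙ (y ∙ s) ≡ y ∙ t
    right = trans (x∙yz≈y∙xz (t - s) y s) (cong (y ∙_) (//-rightDividesˡ s t))

  -≡-⇔-≡- : ∀ {x y z w} → x - y ≡ z - w ⇔ y - w ≡ x - z
  -≡-⇔-≡- {x} {y} {z} {w} = mk⇔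
    (λ eq → sym (to ∙≡∙⇔-≡- (trans (from ∙≡∙⇔-≡- eq) (comm y z))))
    (λ eq → to ∙≡∙⇔-≡- (trans (from ∙≡∙⇔-≡- (sym eq)) (comm z y)))

  cancel-middle : ∀ {p q x w z} → p ∙ x ∙ w ≡ q ∙ x ∙ z ⇔ p ∙ w ≡ q ∙ z
  cancel-middle {p} {q} {x} {w} {z} = mk⇔
    (λ eq → to ∙-cancelʳ-⇔ (trans (sym (xy∙z≈xz∙y p x w)) (trans eq (xy∙z≈xz∙y q x z))))
    (λ eq → trans (xy∙z≈xz∙y p x w) (trans (cong (_∙ x) eq) (sym (xy∙z≈xz∙y q x z))))

  𝟙≟-cong : ∀ {x y u v} → x ≡ y ⇔ u ≡ v → 𝟙 (x ≟ y) ≡ 𝟙 (u ≟ v)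
  𝟙≟-cong {x} {y} {u} {v} x≡y⇔u≡v = 𝟙-cong x≡y⇔u≡v (x ≟ y) (u ≟ v)

  𝟙-refl : ∀ x → 𝟙 (x ≟ x) ≡ 1
  𝟙-refl x rewrite dec-true (x ≟ x) refl = refl

  ⟨⟩≡⇔≡⟨⟩⁻¹ : ∀ {t u} → ⟨ t ⟩ ≡ u ⇔ t ≡ ⟨ u ⟩⁻¹
  ⟨⟩≡⇔≡⟨⟩⁻¹ {t} {u} = mk⇔ (λ eq → trans (sym (strictlyInverseʳ t)) (cong ⟨_⟩⁻¹ eq))
                           (λ eq → trans (cong ⟨_⟩ eq) (strictlyInverseˡ u))

  𝟙-⟨⟩≟⟨⟩ : ∀ s t → 𝟙 (⟨ s ⟩ ≟ ⟨ t ⟩) ≡ 𝟙 (s Fin.≟ t)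
  𝟙-⟨⟩≟⟨⟩ s t = 𝟙-cong (mk⇔ (λ eq → trans (to ⟨⟩≡⇔≡⟨⟩⁻¹ eq) (strictlyInverseʳ t)) (cong ⟨_⟩)) (⟨ s ⟩ ≟ ⟨ t ⟩) (s Fin.≟ t)

  ∑-𝟙-⟨⟩ : ∀ u (f : Fin g → ℕ) → ∑[ t < g ] (𝟙 (⟨ t ⟩ ≟ u) * f t) ≡ f ⟨ u ⟩⁻¹
  ∑-𝟙-⟨⟩ u f = trans (sum-cong-≗ λ t → cong (_* f t) (𝟙-cong ⟨⟩≡⇔≡⟨⟩⁻¹ (⟨ t ⟩ ≟ u) (t Fin.≟ ⟨ u ⟩⁻¹))) (∑-𝟙≟ ⟨ u ⟩⁻¹ f)

  ∑-𝟙-⟨⟩≡1 : ∀ u → ∑[ t < g ] 𝟙 (u ≟ ⟨ t ⟩) ≡ 1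
  ∑-𝟙-⟨⟩≡1 u = trans (sum-cong-≗ λ t → trans (𝟙-sym _≟_ u ⟨ t ⟩) (sym (*-identityʳ _))) (∑-𝟙-⟨⟩ u (λ _ → 1))

  ∑-𝟙-⟨⟩-pair : ∀ u v → ∑[ t < g ] (𝟙 (u ≟ ⟨ t ⟩) * 𝟙 (v ≟ ⟨ t ⟩)) ≡ 𝟙 (u ≟ v)
  ∑-𝟙-⟨⟩-pair u v = begin
    ∑[ t < g ] (𝟙 (u ≟ ⟨ t ⟩) * 𝟙 (v ≟ ⟨ t ⟩)) ≡⟨ sum-cong-≗ (λ t → cong₂ _*_ (𝟙-sym _≟_ u ⟨ t ⟩) (𝟙-sym _≟_ v ⟨ t ⟩)) ⟩
    ∑[ t < g ] (𝟙 (⟨ t ⟩ ≟ u) * 𝟙 (⟨ t ⟩ ≟ v)) ≡⟨ ∑-𝟙-⟨⟩ u _ ⟩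
    𝟙 (⟨ ⟨ u ⟩⁻¹ ⟩ ≟ v)                          ≡⟨ cong (λ w → 𝟙 (w ≟ v)) (strictlyInverseˡ u) ⟩
    𝟙 (u ≟ v)                                   ∎
    where open ≡-Reasoning

  ∑-𝟙-translate : ∀ u v u′ v′ →
    ∑[ t < g ] (𝟙 (⟨ t ⟩ ∙ u ≟ v) * 𝟙 (⟨ t ⟩ ∙ u′ ≟ v′)) ≡ 𝟙 (v ∙ u′ ≟ v′ ∙ u)
  ∑-𝟙-translate u v u′ v′ = begin
    ∑[ t < g ] (𝟙 (⟨ t ⟩ ∙ u ≟ v) * 𝟙 (⟨ t ⟩ ∙ u′ ≟ v′)) ≡⟨ sum-cong-≗ (λ t → cong (_* 𝟙 (⟨ t ⟩ ∙ u′ ≟ v′)) (𝟙≟-cong ∙≡⇔≡-)) ⟩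
    ∑[ t < g ] (𝟙 (⟨ t ⟩ ≟ v - u) * 𝟙 (⟨ t ⟩ ∙ u′ ≟ v′)) ≡⟨ ∑-𝟙-⟨⟩ (v - u) _ ⟩
    𝟙 (⟨ ⟨ v - u ⟩⁻¹ ⟩ ∙ u′ ≟ v′)                       ≡⟨ cong (λ w → 𝟙 (w ∙ u′ ≟ v′)) (strictlyInverseˡ _) ⟩
    𝟙 ((v - u) ∙ u′ ≟ v′)                                ≡⟨ 𝟙≟-cong shift ⟩
    𝟙 (v ∙ u′ ≟ v′ ∙ u)                                  ∎
    where
    open ≡-Reasoning
    restore : ((v - u) ∙ u′) ∙ u ≡ v ∙ u′
    restore = trans (xy∙z≈xz∙y (v - u) u′ u) (cong (_∙ u′) (//-rightDividesˡ u v))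
    shift : (v - u) ∙ u′ ≡ v′ ⇔ v ∙ u′ ≡ v′ ∙ u
    shift = mk⇔ (λ eq → trans (sym restore) (cong (_∙ u) eq))
                (λ eq → ∙-cancelʳ u _ _ (trans restore eq))

  permutationMatrix : G → Fin g → Fin g → ℕ
  permutationMatrix x a b = 𝟙 (⟨ b ⟩ ≟ ⟨ a ⟩ ∙ x)

  ∑-permutationMatrix² : ∀ x y b c →
    ∑[ a < g ] (permutationMatrix x a b * permutationMatrix y a c) ≡ 𝟙 (⟨ b ⟩ ∙ y ≟ ⟨ c ⟩ ∙ x)
  ∑-permutationMatrix² x y b c =
    trans (sum-cong-≗ {g} λ a → cong₂ _*_ (𝟙-sym _≟_ ⟨ b ⟩ (⟨ a ⟩ ∙ x)) (𝟙-sym _≟_ ⟨ c ⟩ (⟨ a ⟩ ∙ y))) (∑-𝟙-translate x ⟨ b ⟩ y ⟨ c ⟩)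

  IsGeneralizedHadamard : (l : ℕ) → (Fin (g * l) → Fin (g * l) → G) → Set
  IsGeneralizedHadamard l H = ∀ i k → i ≢ k → ∀ x → ∑[ j < g * l ] 𝟙 (H i j - H k j ≟ x) ≡ l

  module _ {l : ℕ} {H : Fin (g * l) → Fin (g * l) → G} (isGH : IsGeneralizedHadamard l H) where

    private
      n = g * l

      colDiff : Fin n → Fin n → Fin n → G
      colDiff c c′ b = H b c - H b c′

      count : Fin n → Fin n → Fin g → ℕ
      count c c′ t = ∑[ b < n ] 𝟙 (colDiff c c′ b ≟ ⟨ t ⟩)

      deviation : Fin n → Fin n → ℕ
      deviation c c′ = ∑[ t < g ] (∣ count c c′ t - l ∣ * ∣ count c c′ t - l ∣)

      ∑-count : ∀ c c′ → ∑[ t < g ] count c c′ t ≡ n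
      ∑-count c c′ = begin
        ∑[ t < g ] ∑[ b < n ] 𝟙 (colDiff c c′ b ≟ ⟨ t ⟩) ≡⟨ ∑-comm (λ t b → 𝟙 (colDiff c c′ b ≟ ⟨ t ⟩)) ⟩
        ∑[ b < n ] ∑[ t < g ] 𝟙 (colDiff c c′ b ≟ ⟨ t ⟩) ≡⟨ sum-cong-≗ (λ b → ∑-𝟙-⟨⟩≡1 (colDiff c c′ b)) ⟩
        ∑[ b < n ] 1                                     ≡⟨ trans (∑-const n 1) (*-identityʳ n) ⟩
        n                                                ∎
        where open ≡-Reasoning

      ∑-count² : ∀ c c′ →
        ∑[ t < g ] (count c c′ t * count c c′ t) ≡ ∑[ b < n ] ∑[ b′ < n ] 𝟙 (colDiff c c′ b ≟ colDiff c c′ b′)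
      ∑-count² c c′ = begin
        ∑[ t < g ] (count c c′ t * count c c′ t)
          ≡⟨ sum-cong-≗ (λ t → ∑-*-∑ (λ b → 𝟙 (D b ≟ ⟨ t ⟩)) (λ b′ → 𝟙 (D b′ ≟ ⟨ t ⟩))) ⟩
        ∑[ t < g ] ∑[ b < n ] ∑[ b′ < n ] (𝟙 (D b ≟ ⟨ t ⟩) * 𝟙 (D b′ ≟ ⟨ t ⟩))
          ≡⟨ ∑-comm (λ t b → ∑[ b′ < n ] (𝟙 (D b ≟ ⟨ t ⟩) * 𝟙 (D b′ ≟ ⟨ t ⟩))) ⟩
        ∑[ b < n ] ∑[ t < g ] ∑[ b′ < n ] (𝟙 (D b ≟ ⟨ t ⟩) * 𝟙 (D b′ ≟ ⟨ t ⟩))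
          ≡⟨ sum-cong-≗ (λ b → ∑-comm (λ t b′ → 𝟙 (D b ≟ ⟨ t ⟩) * 𝟙 (D b′ ≟ ⟨ t ⟩))) ⟩
        ∑[ b < n ] ∑[ b′ < n ] ∑[ t < g ] (𝟙 (D b ≟ ⟨ t ⟩) * 𝟙 (D b′ ≟ ⟨ t ⟩))
          ≡⟨ sum-cong-≗ (λ b → sum-cong-≗ λ b′ → ∑-𝟙-⟨⟩-pair (D b) (D b′)) ⟩
        ∑[ b < n ] ∑[ b′ < n ] 𝟙 (D b ≟ D b′) ∎
        where
        open ≡-Reasoning
        D = colDiff c c′

      ∑-count²-split : ∀ c c′ →
        ∑[ t < g ] (count c c′ t * count c c′ t) ≡ onDiagonal (n * n) (n * l) c c′ + onDiagonal 0 (deviation c c′) c c′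
      ∑-count²-split c c′ with c Fin.≟ c′
      ... | yes refl = begin
        ∑[ t < g ] (count c c t * count c c t) ≡⟨ ∑-count² c c ⟩
        ∑[ b < n ] ∑[ b′ < n ] 𝟙 (colDiff c c b ≟ colDiff c c b′)
          ≡⟨ sum-cong-≗ (λ b → trans (sum-cong-≗ λ b′ → all-agree b b′) (∑-const n 1)) ⟩
        ∑[ b < n ] (n * 1)                     ≡⟨ ∑-const n (n * 1) ⟩
        n * (n * 1)                            ≡⟨ cong (n *_) (*-identityʳ n) ⟩
        n * n                                  ≡⟨ +-identityʳ (n * n) ⟨
        n * n + 0                              ∎
        where
        open ≡-Reasoning
        all-agree : ∀ b b′ → 𝟙 (colDiff c c b ≟ colDiff c c b′) ≡ 1
        all-agree b b′ = trans (cong₂ (λ u v → 𝟙 (u ≟ v)) (inverseʳ (H b c)) (inverseʳ (H b′ c))) (𝟙-refl _)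
      ... | no _ = ∑N²≡gl²+∑∣N-l∣² l (count c c′) (∑-count c c′)

      agreements : ∀ b b′ → ∑[ c < n ] ∑[ c′ < n ] 𝟙 (colDiff c c′ b ≟ colDiff c c′ b′) ≡ onDiagonal (n * n) (n * l) b b′
      agreements b b′ with b Fin.≟ b′
      ... | yes refl = trans (sum-cong-≗ λ c → trans (sum-cong-≗ λ c′ → 𝟙-refl (colDiff c c′ b)) (∑-const n 1))
                             (trans (∑-const n (n * 1)) (cong (n *_) (*-identityʳ n)))
      ... | no b≢b′ = trans (sum-cong-≗ λ c → trans (sum-cong-≗ {n} λ c′ → 𝟙≟-cong -≡-⇔-≡-) (isGH b b′ b≢b′ (H b c - H b′ c)))
                            (∑-const n l)

      deviation≡0 : ∀ c c′ → onDiagonal 0 (deviation c c′) c c′ ≡ 0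
      deviation≡0 c = ∑≡0⇒≗0 (λ c′ → onDiagonal 0 (deviation c c′) c c′) (∑-+-≡⇒≗0 _ _ total c)
        where
        open ≡-Reasoning
        total : ∑[ c < n ] (∑[ c′ < n ] onDiagonal (n * n) (n * l) c c′ + ∑[ c′ < n ] onDiagonal 0 (deviation c c′) c c′)
              ≡ ∑[ c < n ] ∑[ c′ < n ] onDiagonal (n * n) (n * l) c c′
        total = begin
          ∑[ c < n ] (∑[ c′ < n ] onDiagonal (n * n) (n * l) c c′ + ∑[ c′ < n ] onDiagonal 0 (deviation c c′) c c′)
            ≡⟨ sum-cong-≗ (λ c → ∑-distrib-+ (onDiagonal (n * n) (n * l) c) (λ c′ → onDiagonal 0 (deviation c c′) c c′)) ⟨
          ∑[ c < n ] ∑[ c′ < n ] (onDiagonal (n * n) (n * l) c c′ + onDiagonal 0 (deviation c c′) c c′)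
            ≡⟨ sum-cong-≗ (λ c → sum-cong-≗ λ c′ → ∑-count²-split c c′) ⟨
          ∑[ c < n ] ∑[ c′ < n ] ∑[ t < g ] (count c c′ t * count c c′ t)
            ≡⟨ sum-cong-≗ (λ c → sum-cong-≗ λ c′ → ∑-count² c c′) ⟩
          ∑[ c < n ] ∑[ c′ < n ] ∑[ b < n ] ∑[ b′ < n ] 𝟙 (colDiff c c′ b ≟ colDiff c c′ b′)
            ≡⟨ ∑-comm₄ (λ c c′ b b′ → 𝟙 (colDiff c c′ b ≟ colDiff c c′ b′)) ⟩
          ∑[ b < n ] ∑[ b′ < n ] ∑[ c < n ] ∑[ c′ < n ] 𝟙 (colDiff c c′ b ≟ colDiff c c′ b′)
            ≡⟨ sum-cong-≗ (λ b → sum-cong-≗ λ b′ → agreements b b′) ⟩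
          ∑[ b < n ] ∑[ b′ < n ] onDiagonal (n * n) (n * l) b b′ ∎

    isGeneralizedHadamard-transpose : IsGeneralizedHadamard l (λ i j → H j i)
    isGeneralizedHadamard-transpose c c′ c≢c′ x = begin
      ∑[ b < n ] 𝟙 (H b c - H b c′ ≟ x)          ≡⟨ sum-cong-≗ (λ b → cong (λ y → 𝟙 (H b c - H b c′ ≟ y)) (strictlyInverseˡ x)) ⟨
      count c c′ (⟨ x ⟩⁻¹)                         ≡⟨ ∑∣N-l∣²≡0⇒N≗l l (count c c′) deviation≡0′ (⟨ x ⟩⁻¹) ⟩
      l                                           ∎
      where
      open ≡-Reasoning
      deviation≡0′ : deviation c c′ ≡ 0
      deviation≡0′ with c Fin.≟ c′ | deviation≡0 c c′
      ... | yes c≡c′ | _ = ⊥-elim (c≢c′ c≡c′)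
      ... | no _ | eq = eq

    blockSum : (r r′ c c′ : Fin n) (p q : G) → ℕ
    blockSum r r′ c c′ p q = ∑[ b < n ] ∑[ a < n ] 𝟙 (p ∙ H r a ∙ H b c′ ≟ q ∙ H r′ a ∙ H b c)

    blockSum-rows : ∀ {r r′} c c′ p q → r ≢ r′ → blockSum r r′ c c′ p q ≡ n * l
    blockSum-rows {r} {r′} c c′ p q r≢r′ =
      trans (sum-cong-≗ λ b → trans (sum-cong-≗ {n} λ a → 𝟙≟-cong regroup) (isGH r r′ r≢r′ (q ∙ H b c - p ∙ H b c′)))
            (∑-const n l)
      where
      regroup : ∀ {x y w z} → p ∙ x ∙ w ≡ q ∙ y ∙ z ⇔ x - y ≡ q ∙ z - p ∙ w
      regroup {x} {y} {w} {z} = mk⇔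
        (λ eq → to ∙≡∙⇔-≡- (trans (sym (xy∙z≈y∙xz p x w)) (trans eq (xy∙z≈y∙xz q y z))))
        (λ eq → trans (xy∙z≈y∙xz p x w) (trans (from ∙≡∙⇔-≡- eq) (sym (xy∙z≈y∙xz q y z))))

    blockSum-cols : ∀ r {c c′} p q → c ≢ c′ → blockSum r r c c′ p q ≡ n * l
    blockSum-cols r {c} {c′} p q c≢c′ = begin
      blockSum r r c c′ p q                       ≡⟨ sum-cong-≗ {n} (λ b → trans (sum-cong-≗ {n} λ a → 𝟙≟-cong regroup) (∑-const n (𝟙 (H b c - H b c′ ≟ p - q)))) ⟩
      ∑[ b < n ] (n * 𝟙 (H b c - H b c′ ≟ p - q)) ≡⟨ *-distribˡ-sum n (λ b → 𝟙 (H b c - H b c′ ≟ p - q)) ⟨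
      n * ∑[ b < n ] 𝟙 (H b c - H b c′ ≟ p - q)   ≡⟨ cong (n *_) (isGeneralizedHadamard-transpose c c′ c≢c′ (p - q)) ⟩
      n * l                                       ∎
      where
      open ≡-Reasoning
      regroup : ∀ {x w z} → p ∙ x ∙ w ≡ q ∙ x ∙ z ⇔ z - w ≡ p - q
      regroup = mk⇔ (λ eq → sym (to ∙≡∙⇔-≡- (to cancel-middle eq)))
                    (λ eq → from cancel-middle (from ∙≡∙⇔-≡- (sym eq)))

    blockSum-diagonal : ∀ r c p q → blockSum r r c c p q ≡ n * (n * 𝟙 (p ≟ q))
    blockSum-diagonal r c p q =
      trans (sum-cong-≗ {n} λ b → trans (sum-cong-≗ {n} λ a → 𝟙≟-cong cancel-both) (∑-const n (𝟙 (p ≟ q))))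
            (∑-const n (n * 𝟙 (p ≟ q)))
      where
      cancel-both : ∀ {x w} → p ∙ x ∙ w ≡ q ∙ x ∙ w ⇔ p ≡ q
      cancel-both = mk⇔ (λ eq → to ∙-cancelʳ-⇔ (to cancel-middle eq))
                        (λ eq → from cancel-middle (cong (_∙ _) eq))

    blockSum-value : ∀ r c s r′ c′ s′ →
      blockSum r r′ c c′ ⟨ s ⟩ ⟨ s′ ⟩ ≡ onDiagonal (n * (n * 𝟙 (s Fin.≟ s′))) (n * l) (combine r c) (combine r′ c′)
    blockSum-value r c s r′ c′ s′ with combine r c Fin.≟ combine r′ c′
    ... | yes rc≡r′c′ with refl , refl ← Fin.combine-injective r c r′ c′ rc≡r′c′ =
      trans (blockSum-diagonal r c ⟨ s ⟩ ⟨ s′ ⟩) (cong (λ k → n * (n * k)) (𝟙-⟨⟩≟⟨⟩ s s′))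
    ... | no rc≢r′c′ with r Fin.≟ r′
    ...   | no r≢r′ = blockSum-rows c c′ ⟨ s ⟩ ⟨ s′ ⟩ r≢r′
    ...   | yes refl = blockSum-cols r ⟨ s ⟩ ⟨ s′ ⟩ (λ c≡c′ → rc≢r′c′ (cong (combine r) c≡c′))

    -- The entry of M in row (i, j₁, b₁) and column (j, j₂, b₂), that is, of D_ij = φ(h_j)ᵀφ(h_i)
    -- in row (j₁, b₁) and column (j₂, b₂).
    entry : (i j₁ : Fin n) (b₁ : Fin g) (j j₂ : Fin n) (b₂ : Fin g) → ℕ
    entry i j₁ b₁ j j₂ b₂ = ∑[ a < g ] (permutationMatrix (H j j₁) a b₁ * permutationMatrix (H i j₂) a b₂)

    rowGram≡blockSum : ∀ i j₁ b₁ k k₁ e₁ →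
      ∑[ j < n ] ∑[ j₂ < n ] ∑[ b₂ < g ] (entry i j₁ b₁ j j₂ b₂ * entry k k₁ e₁ j j₂ b₂) ≡ blockSum i k j₁ k₁ ⟨ b₁ ⟩ ⟨ e₁ ⟩
    rowGram≡blockSum i j₁ b₁ k k₁ e₁ = sum-cong-≗ λ j → sum-cong-≗ λ j₂ → begin
      ∑[ b₂ < g ] (entry i j₁ b₁ j j₂ b₂ * entry k k₁ e₁ j j₂ b₂)
        ≡⟨ sum-cong-≗ (λ b₂ → cong₂ _*_
             (trans (∑-permutationMatrix² _ _ b₁ b₂) (𝟙-sym _≟_ _ _))
             (trans (∑-permutationMatrix² _ _ e₁ b₂) (𝟙-sym _≟_ _ _))) ⟩
      ∑[ b₂ < g ] (𝟙 (⟨ b₂ ⟩ ∙ H j j₁ ≟ ⟨ b₁ ⟩ ∙ H i j₂) * 𝟙 (⟨ b₂ ⟩ ∙ H j k₁ ≟ ⟨ e₁ ⟩ ∙ H k j₂))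
        ≡⟨ ∑-𝟙-translate (H j j₁) (⟨ b₁ ⟩ ∙ H i j₂) (H j k₁) (⟨ e₁ ⟩ ∙ H k j₂) ⟩
      𝟙 (⟨ b₁ ⟩ ∙ H i j₂ ∙ H j k₁ ≟ ⟨ e₁ ⟩ ∙ H k j₂ ∙ H j j₁) ∎
      where open ≡-Reasoning

    colGram≡blockSum : ∀ j j₂ b₂ k k₂ e₂ →
      ∑[ i < n ] ∑[ j₁ < n ] ∑[ b₁ < g ] (entry i j₁ b₁ j j₂ b₂ * entry i j₁ b₁ k k₂ e₂) ≡ blockSum j k j₂ k₂ ⟨ b₂ ⟩ ⟨ e₂ ⟩
    colGram≡blockSum j j₂ b₂ k k₂ e₂ = sum-cong-≗ λ i → sum-cong-≗ λ j₁ → begin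
      ∑[ b₁ < g ] (entry i j₁ b₁ j j₂ b₂ * entry i j₁ b₁ k k₂ e₂)
        ≡⟨ sum-cong-≗ (λ b₁ → cong₂ _*_ (∑-permutationMatrix² _ _ b₁ b₂) (∑-permutationMatrix² _ _ b₁ e₂)) ⟩
      ∑[ b₁ < g ] (𝟙 (⟨ b₁ ⟩ ∙ H i j₂ ≟ ⟨ b₂ ⟩ ∙ H j j₁) * 𝟙 (⟨ b₁ ⟩ ∙ H i k₂ ≟ ⟨ e₂ ⟩ ∙ H k j₁))
        ≡⟨ ∑-𝟙-translate (H i j₂) (⟨ b₂ ⟩ ∙ H j j₁) (H i k₂) (⟨ e₂ ⟩ ∙ H k j₁) ⟩
      𝟙 (⟨ b₂ ⟩ ∙ H j j₁ ∙ H i k₂ ≟ ⟨ e₂ ⟩ ∙ H k j₁ ∙ H i j₂) ∎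
      where open ≡-Reasoning

[m+n%d]%d≡[m+n]%d : ∀ m n d .{{_ : NonZero d}} → (m + n % d) % d ≡ (m + n) % d
[m+n%d]%d≡[m+n]%d m n d = begin
  (m + n % d) % d           ≡⟨ %-distribˡ-+ m (n % d) d ⟩
  (m % d + n % d % d) % d   ≡⟨ cong (λ k → (m % d + k) % d) (m%n%n≡m%n n d) ⟩
  (m % d + n % d) % d       ≡⟨ %-distribˡ-+ m n d ⟨
  (m + n) % d               ∎
  where open ≡-Reasoning

[m%d+n]%d≡[m+n]%d : ∀ m n d .{{_ : NonZero d}} → (m % d + n) % d ≡ (m + n) % d
[m%d+n]%d≡[m+n]%d m n d =
  trans (cong (_% d) (+-comm (m % d) n)) (trans ([m+n%d]%d≡[m+n]%d n m d) (cong (_% d) (+-comm n m)))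

isAbelianGroup-≡ : ∀ {A : Set} {_∙_ : Op₂ A} {ε : A} {_⁻¹ : Op₁ A} →
  (∀ x y z → (x ∙ y) ∙ z ≡ x ∙ (y ∙ z)) → (∀ x y → x ∙ y ≡ y ∙ x) →
  (∀ x → ε ∙ x ≡ x) → (∀ x → x ∙ (x ⁻¹) ≡ ε) → Structures.IsAbelianGroup _≡_ _∙_ ε _⁻¹
isAbelianGroup-≡ {_⁻¹ = _⁻¹} assoc comm identityˡ inverseʳ = record
  { isGroup = record
    { isMonoid = record
      { isSemigroup = record
        { isMagma = record { isEquivalence = isEquivalence ; ∙-cong = cong₂ _ }
        ; assoc = assoc
        }
      ; identity = comm∧idˡ⇒id comm identityˡ
      }
    ; inverse = comm∧invʳ⇒inv comm inverseʳ
    ; ⁻¹-cong = cong _⁻¹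
    }
  ; comm = comm
  }

module _ {m : ℕ} where

  infixl 6 _+ₘ_
  _+ₘ_ : Fin (suc m) → Fin (suc m) → Fin (suc m)
  a +ₘ b = fromℕ< (m%n<n (toℕ a + toℕ b) (suc m))

  -ₘ_ : Fin (suc m) → Fin (suc m)
  -ₘ b = fromℕ< (m%n<n (suc m ∸ toℕ b) (suc m))

  toℕ-+ₘ : ∀ a b → toℕ (a +ₘ b) ≡ (toℕ a + toℕ b) % suc m
  toℕ-+ₘ a b = Fin.toℕ-fromℕ< _

  subF≡+ₘ-ₘ : ∀ a b → subF a b ≡ a +ₘ -ₘ b
  subF≡+ₘ-ₘ a b = Fin.toℕ-injective (begin
    toℕ (subF a b)                          ≡⟨ Fin.toℕ-fromℕ< _ ⟩
    (toℕ a + (suc m ∸ toℕ b)) % suc m       ≡⟨ [m+n%d]%d≡[m+n]%d (toℕ a) _ (suc m) ⟨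
    (toℕ a + (suc m ∸ toℕ b) % suc m) % suc m ≡⟨ cong (λ k → (toℕ a + k) % suc m) (Fin.toℕ-fromℕ< _) ⟨
    (toℕ a + toℕ (-ₘ b)) % suc m            ≡⟨ toℕ-+ₘ a (-ₘ b) ⟨
    toℕ (a +ₘ -ₘ b)                         ∎)
    where open ≡-Reasoning

  +ₘ-assoc : ∀ a b c → (a +ₘ b) +ₘ c ≡ a +ₘ (b +ₘ c)
  +ₘ-assoc a b c = Fin.toℕ-injective (begin
    toℕ ((a +ₘ b) +ₘ c)                       ≡⟨ toℕ-+ₘ (a +ₘ b) c ⟩
    (toℕ (a +ₘ b) + toℕ c) % suc m            ≡⟨ cong (λ k → (k + toℕ c) % suc m) (toℕ-+ₘ a b) ⟩
    ((toℕ a + toℕ b) % suc m + toℕ c) % suc m ≡⟨ [m%d+n]%d≡[m+n]%d (toℕ a + toℕ b) (toℕ c) (suc m) ⟩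
    (toℕ a + toℕ b + toℕ c) % suc m           ≡⟨ cong (_% suc m) (+-assoc (toℕ a) (toℕ b) (toℕ c)) ⟩
    (toℕ a + (toℕ b + toℕ c)) % suc m         ≡⟨ [m+n%d]%d≡[m+n]%d (toℕ a) (toℕ b + toℕ c) (suc m) ⟨
    (toℕ a + (toℕ b + toℕ c) % suc m) % suc m ≡⟨ cong (λ k → (toℕ a + k) % suc m) (toℕ-+ₘ b c) ⟨
    (toℕ a + toℕ (b +ₘ c)) % suc m            ≡⟨ toℕ-+ₘ a (b +ₘ c) ⟨
    toℕ (a +ₘ (b +ₘ c))                       ∎)
    where open ≡-Reasoning

  +ₘ-comm : ∀ a b → a +ₘ b ≡ b +ₘ a
  +ₘ-comm a b = Fin.toℕ-injective (trans (toℕ-+ₘ a b) (trans (cong (_% suc m) (+-comm (toℕ a) (toℕ b))) (sym (toℕ-+ₘ b a))))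

  +ₘ-identityˡ : ∀ a → Fin.zero +ₘ a ≡ a
  +ₘ-identityˡ a = Fin.toℕ-injective (trans (toℕ-+ₘ Fin.zero a) (m<n⇒m%n≡m (Fin.toℕ<n a)))

  +ₘ-inverseʳ : ∀ a → a +ₘ -ₘ a ≡ Fin.zero
  +ₘ-inverseʳ a = Fin.toℕ-injective (begin
    toℕ (a +ₘ -ₘ a)                           ≡⟨ toℕ-+ₘ a (-ₘ a) ⟩
    (toℕ a + toℕ (-ₘ a)) % suc m              ≡⟨ cong (λ k → (toℕ a + k) % suc m) (Fin.toℕ-fromℕ< _) ⟩
    (toℕ a + (suc m ∸ toℕ a) % suc m) % suc m ≡⟨ [m+n%d]%d≡[m+n]%d (toℕ a) _ (suc m) ⟩
    (toℕ a + (suc m ∸ toℕ a)) % suc m         ≡⟨ cong (_% suc m) (m+[n∸m]≡n (Fin.toℕ≤n a)) ⟩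
    suc m % suc m                             ≡⟨ n%n≡0 (suc m) ⟩
    0                                         ∎)
    where open ≡-Reasoning

addᴱ : ∀ {ns} → All (1 ≤_) ns → Elem ns → Elem ns → Elem ns
addᴱ [] _ _ = tt
addᴱ (s≤s _ ∷ p) (a , x) (b , y) = a +ₘ b , addᴱ p x y

negᴱ : ∀ {ns} → All (1 ≤_) ns → Elem ns → Elem ns
negᴱ [] _ = tt
negᴱ (s≤s _ ∷ p) (a , x) = -ₘ a , negᴱ p x

zeroᴱ : ∀ {ns} → All (1 ≤_) ns → Elem ns
zeroᴱ [] = tt
zeroᴱ (s≤s _ ∷ p) = Fin.zero , zeroᴱ p

subE≡addᴱ-negᴱ : ∀ {ns} (p : All (1 ≤_) ns) x y → subE x y ≡ addᴱ p x (negᴱ p y)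
subE≡addᴱ-negᴱ [] _ _ = refl
subE≡addᴱ-negᴱ (s≤s _ ∷ p) (a , x) (b , y) = cong₂ _,_ (subF≡+ₘ-ₘ a b) (subE≡addᴱ-negᴱ p x y)

addᴱ-isAbelianGroup : ∀ {ns} (p : All (1 ≤_) ns) → Structures.IsAbelianGroup _≡_ (addᴱ p) (zeroᴱ p) (negᴱ p)
addᴱ-isAbelianGroup p = isAbelianGroup-≡ (assoc p) (comm p) (identityˡ p) (inverseʳ p)
  where
  assoc : ∀ {ns} (p : All (1 ≤_) ns) x y z → addᴱ p (addᴱ p x y) z ≡ addᴱ p x (addᴱ p y z)
  assoc [] _ _ _ = refl
  assoc (s≤s _ ∷ p) (a , x) (b , y) (c , z) = cong₂ _,_ (+ₘ-assoc a b c) (assoc p x y z)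
  comm : ∀ {ns} (p : All (1 ≤_) ns) x y → addᴱ p x y ≡ addᴱ p y x
  comm [] _ _ = refl
  comm (s≤s _ ∷ p) (a , x) (b , y) = cong₂ _,_ (+ₘ-comm a b) (comm p x y)
  identityˡ : ∀ {ns} (p : All (1 ≤_) ns) x → addᴱ p (zeroᴱ p) x ≡ x
  identityˡ [] _ = refl
  identityˡ (s≤s _ ∷ p) (a , x) = cong₂ _,_ (+ₘ-identityˡ a) (identityˡ p x)
  inverseʳ : ∀ {ns} (p : All (1 ≤_) ns) x → addᴱ p x (negᴱ p x) ≡ zeroᴱ p
  inverseʳ [] _ = refl
  inverseʳ (s≤s _ ∷ p) (a , x) = cong₂ _,_ (+ₘ-inverseʳ a) (inverseʳ p x)

eqE-sound : ∀ {ns} (x y : Elem ns) → T (eqE x y) → x ≡ y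
eqE-sound {[]} _ _ _ = refl
eqE-sound {n ∷ ns} (a , x) (b , y) eq with Equivalence.to T-∧ eq
... | a≡ᵇb , x≈y = cong₂ _,_ (Fin.toℕ-injective (≡ᵇ⇒≡ (toℕ a) (toℕ b) a≡ᵇb)) (eqE-sound x y x≈y)

eqE-refl : ∀ {ns} (x : Elem ns) → T (eqE x x)
eqE-refl {[]} _ = _
eqE-refl {n ∷ ns} (a , x) = Equivalence.from T-∧ (≡⇒≡ᵇ (toℕ a) (toℕ a) refl , eqE-refl x)

_≟ᴱ_ : ∀ {ns} → DecidableEquality (Elem ns)
x ≟ᴱ y = map′ (eqE-sound x y) (λ { refl → eqE-refl x }) (T? (eqE x y))

fromFin : ∀ ns → Fin (product ns) → Elem ns
fromFin [] _ = tt
fromFin (n ∷ ns) t = proj₁ (remQuot {n} (product ns) t) , fromFin ns (proj₂ (remQuot {n} (product ns) t))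

toFin : ∀ ns → Elem ns → Fin (product ns)
toFin [] _ = Fin.zero
toFin (n ∷ ns) (a , x) = combine a (toFin ns x)

enumElem : ∀ ns → Fin (product ns) ↔ Elem ns
enumElem ns = mk↔ₛ′ (fromFin ns) (toFin ns) (fromFin-toFin ns) (toFin-fromFin ns)
  where
  fromFin-toFin : ∀ ns x → fromFin ns (toFin ns x) ≡ x
  fromFin-toFin [] _ = refl
  fromFin-toFin (n ∷ ns) (a , x) =
    trans (cong (λ q → proj₁ q , fromFin ns (proj₂ q)) (Fin.remQuot-combine {n} {product ns} a (toFin ns x)))
          (cong (a ,_) (fromFin-toFin ns x))
  toFin-fromFin : ∀ ns t → toFin ns (fromFin ns t) ≡ t
  toFin-fromFin [] Fin.zero = refl
  toFin-fromFin (n ∷ ns) t =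
    trans (cong (combine (proj₁ (remQuot {n} (product ns) t))) (toFin-fromFin ns _)) (Fin.combine-remQuot {n} (product ns) t)

kron-remQuot : ∀ {m n p q} (A : Mat m n) (B : Mat p q) r c →
  kron A B r c ≡ A (proj₁ (remQuot {m} p r)) (proj₁ (remQuot {n} q c)) * B (proj₂ (remQuot {m} p r)) (proj₂ (remQuot {n} q c))
kron-remQuot {m} {n} {p} {q} A B r c with remQuot {m} p r | remQuot {n} q c
... | _ , _ | _ , _ = refl

mpow-circ : ∀ m e (a b : Fin (suc m)) → mpow (circ (suc m)) e a b ≡ 𝟙 (toℕ b ℕ.≟ (toℕ a + e) % suc m)
mpow-circ m zero a b = trans (𝟙-sym ℕ._≟_ (toℕ a) (toℕ b)) (cong (λ k → 𝟙 (toℕ b ℕ.≟ k)) (sym [a+0]%[1+m]≡a))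
  where
  [a+0]%[1+m]≡a : (toℕ a + 0) % suc m ≡ toℕ a
  [a+0]%[1+m]≡a = trans (cong (_% suc m) (+-identityʳ (toℕ a))) (m<n⇒m%n≡m (Fin.toℕ<n a))
mpow-circ m (suc e) a b = begin
  sumF (λ j → circ (suc m) a j * mpow (circ (suc m)) e j b)
    ≡⟨ sumF≡∑ (λ j → circ (suc m) a j * mpow (circ (suc m)) e j b) ⟩
  ∑[ j < suc m ] (circ (suc m) a j * mpow (circ (suc m)) e j b)
    ≡⟨ sum-cong-≗ (λ j → cong₂ _*_ (𝟙-cong toℕ≡⇔≡a+1 (toℕ j ℕ.≟ suc (toℕ a) % suc m) (j Fin.≟ a+1)) (mpow-circ m e j b)) ⟩
  ∑[ j < suc m ] (𝟙 (j Fin.≟ a+1) * 𝟙 (toℕ b ℕ.≟ (toℕ j + e) % suc m))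
    ≡⟨ ∑-𝟙≟ a+1 (λ j → 𝟙 (toℕ b ℕ.≟ (toℕ j + e) % suc m)) ⟩
  𝟙 (toℕ b ℕ.≟ (toℕ a+1 + e) % suc m)
    ≡⟨ cong (λ k → 𝟙 (toℕ b ℕ.≟ k)) shift ⟩
  𝟙 (toℕ b ℕ.≟ (toℕ a + suc e) % suc m) ∎
  where
  open ≡-Reasoning
  a+1 : Fin (suc m)
  a+1 = fromℕ< (m%n<n (suc (toℕ a)) (suc m))
  toℕ-a+1 : toℕ a+1 ≡ suc (toℕ a) % suc m
  toℕ-a+1 = Fin.toℕ-fromℕ< (m%n<n (suc (toℕ a)) (suc m))
  toℕ≡⇔≡a+1 : ∀ {j} → toℕ j ≡ suc (toℕ a) % suc m ⇔ j ≡ a+1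
  toℕ≡⇔≡a+1 = mk⇔ (λ eq → Fin.toℕ-injective (trans eq (sym toℕ-a+1))) (λ eq → trans (cong toℕ eq) toℕ-a+1)
  shift : (toℕ a+1 + e) % suc m ≡ (toℕ a + suc e) % suc m
  shift = trans (cong (λ k → (k + e) % suc m) toℕ-a+1)
                (trans ([m%d+n]%d≡[m+n]%d (suc (toℕ a)) e (suc m)) (cong (_% suc m) (sym (+-suc (toℕ a) e))))

module ElemGH {ns : List ℕ} (p : All (1 ≤_) ns) =
  GeneralizedHadamard (addᴱ-isAbelianGroup p) _≟ᴱ_ (enumElem ns)

φ≡permutationMatrix : ∀ {ns} (p : All (1 ≤_) ns) x a b → φ ns x a b ≡ ElemGH.permutationMatrix p x a b
φ≡permutationMatrix [] tt Fin.zero Fin.zero = refl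
φ≡permutationMatrix {suc m ∷ ns} (s≤s 0≤m ∷ p) (x , xs) a b = begin
  kron (mpow (circ (suc m)) (toℕ x)) (φ ns xs) a b
    ≡⟨ kron-remQuot (mpow (circ (suc m)) (toℕ x)) (φ ns xs) a b ⟩
  mpow (circ (suc m)) (toℕ x) qa qb * φ ns xs ra rb
    ≡⟨ cong₂ _*_ (trans (mpow-circ m (toℕ x) qa qb) (cong (λ k → 𝟙 (toℕ qb ℕ.≟ k)) (sym (toℕ-+ₘ qa x))))
                 (φ≡permutationMatrix p xs ra rb) ⟩
  𝟙 (toℕ qb ℕ.≟ toℕ (qa +ₘ x)) * ElemGH.permutationMatrix p xs ra rb
    ≡⟨ 𝟙-×-dec (toℕ qb ℕ.≟ toℕ (qa +ₘ x)) (fromFin ns rb ≟ᴱ addᴱ p (fromFin ns ra) xs) ⟨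
  ElemGH.permutationMatrix (s≤s 0≤m ∷ p) (x , xs) a b ∎
  where
  open ≡-Reasoning
  qa = proj₁ (remQuot {suc m} (product ns) a)
  qb = proj₁ (remQuot {suc m} (product ns) b)
  ra = proj₂ (remQuot {suc m} (product ns) a)
  rb = proj₂ (remQuot {suc m} (product ns) b)

∀-combine : ∀ {a b} {P : Fin (a * b) → Set} → (∀ i j → P (combine i j)) → ∀ r → P r
∀-combine {a} {b} {P} h r =
  subst P (Fin.combine-remQuot {a} b r) (h (proj₁ (remQuot {a} b r)) (proj₂ (remQuot {a} b r)))

∀-combine₃ : ∀ {a b c} {P : Fin (a * (b * c)) → Set} → (∀ i j k → P (combine i (combine j k))) → ∀ r → P r
∀-combine₃ {a} {b} {c} {P} h = ∀-combine {a} {b * c} {P} (λ i → ∀-combine {b} {c} {P ∘ combine i} (h i))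

∑-combine₃ : ∀ a b c (f : Fin (a * (b * c)) → ℕ) →
  ∑[ r < a * (b * c) ] f r ≡ ∑[ i < a ] ∑[ j < b ] ∑[ k < c ] f (combine i (combine j k))
∑-combine₃ a b c f = trans (∑-combine a (b * c) f) (sum-cong-≗ {a} λ i → ∑-combine b c (f ∘ combine i))

combine₃-injective : ∀ {a b c} (i k : Fin a) (j k′ : Fin b) (s t : Fin c) →
  combine i (combine j s) ≡ combine k (combine k′ t) → combine i j ≡ combine k k′ × s ≡ t
combine₃-injective i k j k′ s t eq with Fin.combine-injective i _ k _ eq
... | i≡k , js≡k′t with Fin.combine-injective j s k′ t js≡k′t
...   | j≡k′ , s≡t = cong₂ combine i≡k j≡k′ , s≡t

cast-combine₃ : ∀ {a b c d} .(e : a * (b * c) ≡ d * c) .(e′ : a * b ≡ d) (i : Fin a) (j : Fin b) (k : Fin c) →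
  cast e (combine i (combine j k)) ≡ combine (cast e′ (combine i j)) k
cast-combine₃ {a} {b} {c} e e′ i j k = Fin.toℕ-injective (begin
  toℕ (cast e (combine i (combine j k)))        ≡⟨ Fin.toℕ-cast e _ ⟩
  toℕ (combine i (combine j k))                 ≡⟨ Fin.toℕ-combine i (combine j k) ⟩
  b * c * toℕ i + toℕ (combine j k)             ≡⟨ cong (b * c * toℕ i +_) (Fin.toℕ-combine j k) ⟩
  b * c * toℕ i + (c * toℕ j + toℕ k)           ≡⟨ reassociate b c (toℕ i) (toℕ j) (toℕ k) ⟩
  c * (b * toℕ i + toℕ j) + toℕ k               ≡⟨ cong (λ z → c * z + toℕ k) (Fin.toℕ-combine i j) ⟨
  c * toℕ (combine i j) + toℕ k                 ≡⟨ cong (λ z → c * z + toℕ k) (Fin.toℕ-cast e′ _) ⟨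
  c * toℕ (cast e′ (combine i j)) + toℕ k       ≡⟨ Fin.toℕ-combine (cast e′ (combine i j)) k ⟨
  toℕ (combine (cast e′ (combine i j)) k)       ∎)
  where
  open ≡-Reasoning
  reassociate : ∀ b c i j k → b * c * i + (c * j + k) ≡ c * (b * i + j) + k
  reassociate = solve-∀

Id≡𝟙 : ∀ {q} (x y : Fin q) → Id q x y ≡ 𝟙 (x Fin.≟ y)
Id≡𝟙 x y = 𝟙-cong (mk⇔ Fin.toℕ-injective (cong toℕ)) (toℕ x ℕ.≟ toℕ y) (x Fin.≟ y)

Id-cast : ∀ {a b} .(e : a ≡ b) (x y : Fin a) → Id b (cast e x) (cast e y) ≡ Id a x y
Id-cast e x y rewrite Fin.toℕ-cast e x | Fin.toℕ-cast e y = refl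

kron-combine : ∀ {m n p q} (A : Mat m n) (B : Mat p q) i j k l → kron A B (combine i k) (combine j l) ≡ A i j * B k l
kron-combine {m} {n} {p} {q} A B i j k l =
  trans (kron-remQuot A B (combine i k) (combine j l))
        (cong₂ (λ (u : Fin m × Fin p) (v : Fin n × Fin q) → A (proj₁ u) (proj₁ v) * B (proj₂ u) (proj₂ v)) (Fin.remQuot-combine {m} {p} i k) (Fin.remQuot-combine {n} {q} j l))

module _ (ns : List ℕ) (l : ℕ) (H : Fin (product ns * l) → Fin (product ns * l) → Elem ns) where

  private
    g = product ns
    n = g * l

  phiRow-combine : ∀ i a j b → phiRow ns l H i a (combine j b) ≡ φ ns (H i j) a b
  phiRow-combine i a j b = trans (unfold (combine j b)) (cong (λ (jb : Fin n × Fin g) → φ ns (H i (proj₁ jb)) a (proj₂ jb)) (Fin.remQuot-combine {n} {g} j b))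
    where
    unfold : ∀ c → phiRow ns l H i a c ≡ φ ns (H i (proj₁ (remQuot {n} g c))) a (proj₂ (remQuot {n} g c))
    unfold c with remQuot {n} g c
    ... | _ , _ = refl

  Mmat-combine : ∀ i r j c → Mmat ns l H (combine i r) (combine j c) ≡ Dmat ns l H i j r c
  Mmat-combine i r j c = trans (unfold (combine i r) (combine j c))
    (cong₂ (λ (ir jc : Fin n × Fin (n * g)) → Dmat ns l H (proj₁ ir) (proj₁ jc) (proj₂ ir) (proj₂ jc))
           (Fin.remQuot-combine {n} {n * g} i r) (Fin.remQuot-combine {n} {n * g} j c))
    where
    unfold : ∀ r c → Mmat ns l H r c ≡ Dmat ns l H (proj₁ (remQuot {n} (n * g) r)) (proj₁ (remQuot {n} (n * g) c))
                                                  (proj₂ (remQuot {n} (n * g) r)) (proj₂ (remQuot {n} (n * g) c))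
    unfold r c with remQuot {n} (n * g) r | remQuot {n} (n * g) c
    ... | _ , _ | _ , _ = refl

module Incidence {ns : List ℕ} (p : All (1 ≤_) ns) (l : ℕ)
  (H : Fin (product ns * l) → Fin (product ns * l) → Elem ns) (gh : IsGH ns l H) where

  open ElemGH p

  private
    g = product ns
    n = g * l
    M = Mmat ns l H

  H-isGH : IsGeneralizedHadamard l H
  H-isGH i k i≢k x = begin
    ∑[ j < n ] 𝟙 (addᴱ p (H i j) (negᴱ p (H k j)) ≟ᴱ x)
      ≡⟨ sum-cong-≗ (λ j → cong (λ y → 𝟙 (y ≟ᴱ x)) (subE≡addᴱ-negᴱ p (H i j) (H k j))) ⟨
    ∑[ j < n ] 𝟙 (subE (H i j) (H k j) ≟ᴱ x)
      ≡⟨ sumF≡∑ (λ j → 𝟙 (subE (H i j) (H k j) ≟ᴱ x)) ⟨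
    countF (λ j → eqE (subE (H i j) (H k j)) x)
      ≡⟨ gh i k i≢k x ⟩
    l ∎
    where open ≡-Reasoning

  Mmat-entry : ∀ i j₁ b₁ j j₂ b₂ → M (combine i (combine j₁ b₁)) (combine j (combine j₂ b₂)) ≡ entry H-isGH i j₁ b₁ j j₂ b₂
  Mmat-entry i j₁ b₁ j j₂ b₂ = begin
    M (combine i (combine j₁ b₁)) (combine j (combine j₂ b₂))
      ≡⟨ Mmat-combine ns l H i (combine j₁ b₁) j (combine j₂ b₂) ⟩
    sumF (λ a → phiRow ns l H j a (combine j₁ b₁) * phiRow ns l H i a (combine j₂ b₂))
      ≡⟨ sumF≡∑ (λ a → phiRow ns l H j a (combine j₁ b₁) * phiRow ns l H i a (combine j₂ b₂)) ⟩
    ∑[ a < g ] (phiRow ns l H j a (combine j₁ b₁) * phiRow ns l H i a (combine j₂ b₂))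
      ≡⟨ sum-cong-≗ (λ a → cong₂ _*_
           (trans (phiRow-combine ns l H j a j₁ b₁) (φ≡permutationMatrix p (H j j₁) a b₁))
           (trans (phiRow-combine ns l H i a j₂ b₂) (φ≡permutationMatrix p (H i j₂) a b₂))) ⟩
    entry H-isGH i j₁ b₁ j j₂ b₂ ∎
    where open ≡-Reasoning

  MMᵀ-combine : ∀ i j₁ b₁ k k₁ e₁ →
    mmul M (transpose M) (combine i (combine j₁ b₁)) (combine k (combine k₁ e₁)) ≡ blockSum H-isGH i k j₁ k₁ (fromFin ns b₁) (fromFin ns e₁)
  MMᵀ-combine i j₁ b₁ k k₁ e₁ = begin
    sumF (λ x → M r x * M c x)
      ≡⟨ sumF≡∑ (λ x → M r x * M c x) ⟩
    ∑[ x < n * (n * g) ] (M r x * M c x)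
      ≡⟨ ∑-combine₃ n n g (λ x → M r x * M c x) ⟩
    ∑[ j < n ] ∑[ j₂ < n ] ∑[ b₂ < g ] (M r (combine j (combine j₂ b₂)) * M c (combine j (combine j₂ b₂)))
      ≡⟨ sum-cong-≗ (λ j → sum-cong-≗ λ j₂ → sum-cong-≗ λ b₂ → cong₂ _*_ (Mmat-entry i j₁ b₁ j j₂ b₂) (Mmat-entry k k₁ e₁ j j₂ b₂)) ⟩
    ∑[ j < n ] ∑[ j₂ < n ] ∑[ b₂ < g ] (entry H-isGH i j₁ b₁ j j₂ b₂ * entry H-isGH k k₁ e₁ j j₂ b₂)
      ≡⟨ rowGram≡blockSum H-isGH i j₁ b₁ k k₁ e₁ ⟩
    blockSum H-isGH i k j₁ k₁ (fromFin ns b₁) (fromFin ns e₁) ∎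
    where
    open ≡-Reasoning
    r = combine i (combine j₁ b₁)
    c = combine k (combine k₁ e₁)

  MᵀM-combine : ∀ j j₂ b₂ k k₂ e₂ →
    mmul (transpose M) M (combine j (combine j₂ b₂)) (combine k (combine k₂ e₂)) ≡ blockSum H-isGH j k j₂ k₂ (fromFin ns b₂) (fromFin ns e₂)
  MᵀM-combine j j₂ b₂ k k₂ e₂ = begin
    sumF (λ x → M x r * M x c)
      ≡⟨ sumF≡∑ (λ x → M x r * M x c) ⟩
    ∑[ x < n * (n * g) ] (M x r * M x c)
      ≡⟨ ∑-combine₃ n n g (λ x → M x r * M x c) ⟩
    ∑[ i < n ] ∑[ j₁ < n ] ∑[ b₁ < g ] (M (combine i (combine j₁ b₁)) r * M (combine i (combine j₁ b₁)) c)
      ≡⟨ sum-cong-≗ (λ i → sum-cong-≗ λ j₁ → sum-cong-≗ λ b₁ → cong₂ _*_ (Mmat-entry i j₁ b₁ j j₂ b₂) (Mmat-entry i j₁ b₁ k k₂ e₂)) ⟩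
    ∑[ i < n ] ∑[ j₁ < n ] ∑[ b₁ < g ] (entry H-isGH i j₁ b₁ j j₂ b₂ * entry H-isGH i j₁ b₁ k k₂ e₂)
      ≡⟨ colGram≡blockSum H-isGH j j₂ b₂ k k₂ e₂ ⟩
    blockSum H-isGH j k j₂ k₂ (fromFin ns b₂) (fromFin ns e₂) ∎
    where
    open ≡-Reasoning
    r = combine j (combine j₂ b₂)
    c = combine k (combine k₂ e₂)

  zeroOne : ∀ r c → M r c ≡ 0 ⊎ M r c ≡ 1
  zeroOne = ∀-combine₃ {n} {n} {g} {λ r → ∀ c → M r c ≡ 0 ⊎ M r c ≡ 1} λ i j₁ b₁ →
            ∀-combine₃ {n} {n} {g} {λ c → M _ c ≡ 0 ⊎ M _ c ≡ 1} λ j j₂ b₂ →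
    subst (λ x → x ≡ 0 ⊎ x ≡ 1)
          (sym (trans (Mmat-entry i j₁ b₁ j j₂ b₂) (∑-permutationMatrix² (H j j₁) (H i j₂) b₁ b₂)))
          (𝟙∈01 (addᴱ p (fromFin ns b₁) (H i j₂) ≟ᴱ addᴱ p (fromFin ns b₂) (H j j₁)))

  private
    N = n * (n * g)
    mm = g * g * l * l

  sgddRhs : .(N ≡ mm * g) → Mat N N
  sgddRhs e r c = mm * Id N r c + 0 * (B ∸ Id N r c) + g * l * l * (1 ∸ B)
    where B = kron (Id mm) (Jm g) (cast e r) (cast e c)

  sgddRhs-combine : ∀ .(e : N ≡ mm * g) (i j₁ : Fin n) (b₁ : Fin g) (k k₁ : Fin n) (e₁ : Fin g) →
    sgddRhs e (combine i (combine j₁ b₁)) (combine k (combine k₁ e₁))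
      ≡ onDiagonal (n * (n * 𝟙 (b₁ Fin.≟ e₁))) (n * l) (combine i j₁) (combine k k₁)
  sgddRhs-combine e i j₁ b₁ k k₁ e₁ =
    trans (cong₂ (λ I B → mm * I + 0 * (B ∸ I) + g * l * l * (1 ∸ B)) (Id≡𝟙 r c) blocks-eq) value
    where
    open ≡-Reasoning
    r = combine i (combine j₁ b₁)
    c = combine k (combine k₁ e₁)
    nn≡mm : n * n ≡ mm
    nn≡mm = regroup g l
      where regroup : ∀ g l → g * l * (g * l) ≡ g * g * l * l
            regroup = solve-∀
    blocks-eq : kron (Id mm) (Jm g) (cast e r) (cast e c) ≡ 𝟙 (combine i j₁ Fin.≟ combine k k₁)
    blocks-eq = begin
      kron (Id mm) (Jm g) (cast e r) (cast e c)
        ≡⟨ cong₂ (kron (Id mm) (Jm g)) (cast-combine₃ e nn≡mm i j₁ b₁) (cast-combine₃ e nn≡mm k k₁ e₁) ⟩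
      kron (Id mm) (Jm g) (combine (cast nn≡mm (combine i j₁)) b₁) (combine (cast nn≡mm (combine k k₁)) e₁)
        ≡⟨ kron-combine (Id mm) (Jm g) (cast nn≡mm (combine i j₁)) (cast nn≡mm (combine k k₁)) b₁ e₁ ⟩
      Id mm (cast nn≡mm (combine i j₁)) (cast nn≡mm (combine k k₁)) * 1
        ≡⟨ *-identityʳ _ ⟩
      Id mm (cast nn≡mm (combine i j₁)) (cast nn≡mm (combine k k₁))
        ≡⟨ Id-cast nn≡mm (combine i j₁) (combine k k₁) ⟩
      Id (n * n) (combine i j₁) (combine k k₁)
        ≡⟨ Id≡𝟙 (combine i j₁) (combine k k₁) ⟩
      𝟙 (combine i j₁ Fin.≟ combine k k₁) ∎
    value : mm * 𝟙 (r Fin.≟ c) + 0 * (𝟙 (combine i j₁ Fin.≟ combine k k₁) ∸ 𝟙 (r Fin.≟ c))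
              + g * l * l * (1 ∸ 𝟙 (combine i j₁ Fin.≟ combine k k₁))
          ≡ onDiagonal (n * (n * 𝟙 (b₁ Fin.≟ e₁))) (n * l) (combine i j₁) (combine k k₁)
    value with combine i j₁ Fin.≟ combine k k₁
    ... | yes ij≡kk with refl , refl ← Fin.combine-injective i j₁ k k₁ ij≡kk =
      trans (cong (λ x → mm * x + 0 + g * l * l * 0) same-cell) (diagonal-arith g l (𝟙 (b₁ Fin.≟ e₁)))
      where
      same-cell : 𝟙 (r Fin.≟ c) ≡ 𝟙 (b₁ Fin.≟ e₁)
      same-cell = 𝟙-cong (mk⇔ (proj₂ ∘ combine₃-injective i i j₁ j₁ b₁ e₁) (cong (λ z → combine i (combine j₁ z))))
                         (r Fin.≟ c) (b₁ Fin.≟ e₁)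
      diagonal-arith : ∀ g l x → g * g * l * l * x + 0 + g * l * l * 0 ≡ g * l * (g * l * x)
      diagonal-arith = solve-∀
    ... | no ij≢kk rewrite dec-false (r Fin.≟ c) (ij≢kk ∘ proj₁ ∘ combine₃-injective i k j₁ k₁ b₁ e₁) =
      offDiagonal-arith g l
      where
      offDiagonal-arith : ∀ g l → g * g * l * l * 0 + 0 + g * l * l * 1 ≡ g * l * l
      offDiagonal-arith = solve-∀

  gram≡sgddRhs : ∀ .(e : N ≡ mm * g) (A : Mat N N) →
    (∀ i j₁ b₁ k k₁ e₁ → A (combine i (combine j₁ b₁)) (combine k (combine k₁ e₁))
                          ≡ blockSum H-isGH i k j₁ k₁ (fromFin ns b₁) (fromFin ns e₁)) →
    ∀ r c → A r c ≡ sgddRhs e r c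
  gram≡sgddRhs e A A≡blockSum =
    ∀-combine₃ {n} {n} {g} {λ r → ∀ c → A r c ≡ sgddRhs e r c} λ i j₁ b₁ →
    ∀-combine₃ {n} {n} {g} {λ c → A _ c ≡ sgddRhs e _ c} λ k k₁ e₁ →
    trans (A≡blockSum i j₁ b₁ k k₁ e₁)
          (trans (blockSum-value H-isGH i j₁ b₁ k k₁ e₁) (sym (sgddRhs-combine e i j₁ b₁ k k₁ e₁)))

proposition2p10 : (ns : List ℕ) → All (1 ≤_) ns → (l : ℕ)
    → (H : Fin (product ns * l) → Fin (product ns * l) → Elem ns)
    → IsGH ns l H
    → IsSGDD (product ns * product ns * product ns * l * l)
             (product ns * product ns * l * l)
             (product ns * product ns * l * l)
             (product ns)
             0
             (product ns * l * l)
             (Mmat ns l H)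
proposition2p10 ns p l H gh =
  order (product ns) l , blockOrder (product ns) l , zeroOne , gram≡sgddRhs _ _ MMᵀ-combine , gram≡sgddRhs _ _ MᵀM-combine
  where
  open Incidence p l H gh
  order : ∀ g l → g * l * (g * l * g) ≡ g * g * g * l * l
  order = solve-∀
  blockOrder : ∀ g l → g * g * g * l * l ≡ g * g * l * l * g
  blockOrder = solve-∀
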